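{- Let $E$ be a simple type, let $A_1,\dots,A_m,G$ be subtypes (subformulas) of $E$, let $t$ be a $\beta$-normal $\lambda$-term and $\alpha$ a free variable of $t$ which is not in application position in $t$ (no subterm of $t$ has the form $(\alpha)u$). Let $p_n=\lambda z_1\dots\lambda z_n\lambda z\,z$. If $x_1:A_1,\dots,x_m:A_m\vdash_{\mathcal S}t[p_n/\alpha]:G$, then $Lg(E)\ge n$.
   Context: The simple type system $\mathcal S$: types are built from type variables and type constants with $\rightarrow$ only; judgements $\Gamma\vdash_{\mathcal S}t:A$ for pure $\lambda$-terms are derived by (ax), ($\rightarrow_i$): from $\Gamma,x:B\vdash t:C$ infer $\Gamma\vdash\lambda xt:B\rightarrow C$, and ($\rightarrow_e$): from $\Gamma\vdash u:B\rightarrow C$, $\Gamma\vdash v:B$ infer $\Gamma\vdash(u)v:C$. $Lg(E)$, the length of $E$, is the number of occurrences of $\rightarrow$ in $E$. $t[p_n/\alpha]$ is capture-avoiding substitution. -}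

module Defs where

open import Data.Nat using (ℕ; zero; suc; _+_)
open import Data.Nat.Properties using (_≟_)
open import Data.Product using (_×_; _,_)
open import Data.List using (List; _∷_; [])
open import Relation.Nullary using (¬_; yes; no)
open import Relation.Binary.PropositionalEquality using (_≡_; _≢_)

data Ty : Set where
  tvar  : ℕ → Ty
  tcon  : ℕ → Ty
  _⇒_   : Ty → Ty → Ty

infixr 7 _⇒_

Lg : Ty → ℕ
Lg (tvar _) = 0
Lg (tcon _) = 0
Lg (A ⇒ B)  = suc (Lg A + Lg B)

data _⊑_ : Ty → Ty → Set where
  ⊑-refl : ∀ {A} → A ⊑ A
  ⊑-left  : ∀ {A B C} → A ⊑ B → A ⊑ (B ⇒ C)
  ⊑-right : ∀ {A B C} → A ⊑ C → A ⊑ (B ⇒ C)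

data Term : Set where
  var : ℕ → Term
  lam : ℕ → Term → Term
  app : Term → Term → Term

data IsLam : Term → Set where
  isLam : ∀ {x u} → IsLam (lam x u)

data Normal : Term → Set where
  nvar : ∀ {x} → Normal (var x)
  nlam : ∀ {x t} → Normal t → Normal (lam x t)
  napp : ∀ {u v} → ¬ IsLam u → Normal u → Normal v → Normal (app u v)

data FreeIn (x : ℕ) : Term → Set where
  fvar  : FreeIn x (var x)
  flam  : ∀ {y t} → x ≢ y → FreeIn x t → FreeIn x (lam y t)
  fappˡ : ∀ {u v} → FreeIn x u → FreeIn x (app u v)
  fappʳ : ∀ {u v} → FreeIn x v → FreeIn x (app u v)

data AppPos (x : ℕ) : Term → Set where
  here  : ∀ {u} → AppPos x (app (var x) u)
  inlam : ∀ {y t} → AppPos x t → AppPos x (lam y t)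
  inl   : ∀ {u v} → AppPos x u → AppPos x (app u v)
  inr   : ∀ {u v} → AppPos x v → AppPos x (app u v)

-- t[p/α] for a CLOSED term p (so no capture can occur): replace the free
-- occurrences of α by p.
_[_/_] : Term → Term → ℕ → Term
var x   [ p / α ] with x ≟ α
... | yes _ = p
... | no  _ = var x
lam x t [ p / α ] with x ≟ α
... | yes _ = lam x t
... | no  _ = lam x (t [ p / α ])
app u v [ p / α ] = app (u [ p / α ]) (v [ p / α ])

pₙ : ℕ → Term
pₙ zero    = lam 0 (var 0)
pₙ (suc n) = lam (suc n) (pₙ n)

-- Contexts: lists of declarations; Γ , x:B is (x , B) ∷ Γ, and the latest
-- declaration of a variable is the one in force.
Ctx : Set
Ctx = List (ℕ × Ty)

data _∋_∶_ : Ctx → ℕ → Ty → Set where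
  here  : ∀ {Γ x A} → ((x , A) ∷ Γ) ∋ x ∶ A
  there : ∀ {Γ x y A B} → x ≢ y → Γ ∋ x ∶ A → ((y , B) ∷ Γ) ∋ x ∶ A

data _⊢_∶_ : Ctx → Term → Ty → Set where
  ax  : ∀ {Γ x A} → Γ ∋ x ∶ A → Γ ⊢ var x ∶ A
  →i  : ∀ {Γ x t B C} → ((x , B) ∷ Γ) ⊢ t ∶ C → Γ ⊢ lam x t ∶ (B ⇒ C)
  →e  : ∀ {Γ u v B C} → Γ ⊢ u ∶ (B ⇒ C) → Γ ⊢ v ∶ B → Γ ⊢ app u v ∶ C

module Submission where

-- In a β-normal term t every subterm that is not an
-- abstraction is neutral, i.e. of the form (x)u₁…uₖ.  If all declared types
-- and the target type G are subformulas of E, a simultaneous induction on t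
-- shows that (a) a neutral subterm whose head is not α has a subformula of E
-- as its type (its head's type is read off the context), and (b) every
-- subterm occupying a "checking" position (the whole term, a body of an
-- abstraction, an argument) is expected at a subformula of E.  Since α never
-- occurs in application position, every free occurrence of α sits in a
-- checking position, where it has been replaced by pₙ; and pₙ, being n+1
-- nested abstractions, can only inhabit types of length ≥ n.  Hence
-- n ≤ Lg(subformula) ≤ Lg E.

open import Defs
open import Data.Nat using (ℕ; _≤_; z≤n; s≤s; zero; suc)
open import Data.Nat.Properties
  using (_≟_; ≤-refl; ≤-trans; m≤m+n; m≤n+m; m≤n⇒m≤1+n)
open import Data.Product using (proj₁; proj₂; _×_; _,_)
open import Data.List using (map)
open import Data.List.Relation.Unary.All using (All; _∷_)
open import Data.List.Relation.Unary.Unique.Propositional using (Unique)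
open import Relation.Nullary using (¬_; yes; no)
open import Relation.Binary.PropositionalEquality using (_≢_; refl)
open import Data.Empty using (⊥-elim)

⊑-trans : ∀ {A B C} → A ⊑ B → B ⊑ C → A ⊑ C
⊑-trans p ⊑-refl      = p
⊑-trans p (⊑-left q)  = ⊑-left (⊑-trans p q)
⊑-trans p (⊑-right q) = ⊑-right (⊑-trans p q)

⊑-domain : ∀ {B C E} → (B ⇒ C) ⊑ E → B ⊑ E
⊑-domain = ⊑-trans (⊑-left ⊑-refl)

⊑-codomain : ∀ {B C E} → (B ⇒ C) ⊑ E → C ⊑ E
⊑-codomain = ⊑-trans (⊑-right ⊑-refl)

⊑-Lg : ∀ {A E} → A ⊑ E → Lg A ≤ Lg E
⊑-Lg ⊑-refl                    = ≤-refl
⊑-Lg {E = B ⇒ C} (⊑-left p)  = m≤n⇒m≤1+n (≤-trans (⊑-Lg p) (m≤m+n (Lg B) (Lg C)))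
⊑-Lg {E = B ⇒ C} (⊑-right p) = m≤n⇒m≤1+n (≤-trans (⊑-Lg p) (m≤n+m (Lg C) (Lg B)))

lookup-All : ∀ {P : Ty → Set} {Γ x A} →
             All (λ d → P (proj₂ d)) Γ → Γ ∋ x ∶ A → P A
lookup-All (p ∷ _)  here        = p
lookup-All (_ ∷ ps) (there _ l) = lookup-All ps l

-- pₙ consists of n+1 nested abstractions, so any type of it has at least n
-- arrows (the innermost λz z contributes the (n+1)-st).
pₙ-Lg : ∀ {Γ G} n → Γ ⊢ pₙ n ∶ G → n ≤ Lg G
pₙ-Lg zero    _                   = z≤n
pₙ-Lg (suc n) (→i {B = B} {C} d) = s≤s (≤-trans (pₙ-Lg n d) (m≤n+m (Lg C) (Lg B)))

module Occurrences (E : Ty) (α n : ℕ) where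

  SubCtx : Ctx → Set
  SubCtx Γ = All (λ d → proj₂ d ⊑ E) Γ

  neutral-type : ∀ {Γ G} t → Normal t → ¬ IsLam t → t ≢ var α → ¬ AppPos α t →
                 SubCtx Γ → Γ ⊢ (t [ pₙ n / α ]) ∶ G →
                 G ⊑ E × (FreeIn α t → n ≤ Lg E)

  checked-bound : ∀ {Γ G} t → Normal t → ¬ AppPos α t → SubCtx Γ → G ⊑ E →
                  Γ ⊢ (t [ pₙ n / α ]) ∶ G → FreeIn α t → n ≤ Lg E

  -- (a) A neutral term whose head is not α has a subformula of E as type
  -- (the head's type comes from the context, and each application peels
  -- off a codomain); its free occurrences of α lie in argument positions.
  neutral-type (var x) _ _ x≢α _ Γ⊑ d with x ≟ α
  ... | yes refl = ⊥-elim (x≢α refl)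
  neutral-type (var x) _ _ _ _ Γ⊑ (ax l) | no x≢α =
    lookup-All Γ⊑ l , λ { fvar → ⊥-elim (x≢α refl) }
  neutral-type (lam x t) _ notLam _ _ _ _ = ⊥-elim (notLam isLam)
  neutral-type (app u v) (napp uNotLam nu nv) _ _ noApp Γ⊑ (→e du dv)
    with neutral-type u nu uNotLam (λ { refl → noApp here }) (λ z → noApp (inl z)) Γ⊑ du
  ... | u⊑E , boundᵤ = ⊑-codomain u⊑E , λ
    { (fappˡ fr) → boundᵤ fr
    ; (fappʳ fr) → checked-bound v nv (λ z → noApp (inr z)) Γ⊑ (⊑-domain u⊑E) dv fr }

  -- (b) A term checked against a subformula of E bounds n by Lg E at each
  -- free occurrence of α: at the occurrence itself via pₙ-Lg, under an
  -- abstraction by the split of the arrow type, and in an application by (a).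
  checked-bound (var x) _ _ _ G⊑ d fr with x ≟ α
  ... | yes _ = ≤-trans (pₙ-Lg n d) (⊑-Lg G⊑)
  checked-bound (var x) _ _ _ _ _ fvar | no x≢α = ⊥-elim (x≢α refl)
  checked-bound (lam x t) _ _ _ _ _ fr with x ≟ α
  checked-bound (lam x t) _ _ _ _ _ (flam α≢x _) | yes refl = ⊥-elim (α≢x refl)
  checked-bound (lam x t) (nlam nt) noApp Γ⊑ G⊑ (→i d) (flam _ fr) | no _ =
    checked-bound t nt (λ z → noApp (inlam z)) (⊑-domain G⊑ ∷ Γ⊑) (⊑-codomain G⊑) d fr
  checked-bound (app u v) nt noApp Γ⊑ _ d fr =
    proj₂ (neutral-type (app u v) nt (λ ()) (λ ()) noApp Γ⊑ d) fr

lemma2p2p6 : (E G : Ty) (Γ : Ctx) → Unique (map proj₁ Γ)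
    → All (λ d → proj₂ d ⊑ E) Γ → G ⊑ E
    → (t : Term) (α : ℕ) → Normal t → FreeIn α t → ¬ AppPos α t
    → (n : ℕ) → Γ ⊢ (t [ pₙ n / α ]) ∶ G → n ≤ Lg E
lemma2p2p6 E G Γ _ Γ⊑E G⊑E t α nt αFree noApp n d =
  Occurrences.checked-bound E α n t nt noApp Γ⊑E G⊑E d αFree
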